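{- Let $m\ge2$ and let $\mathcal E_{2m}$ be the graph on $2m$ vertices consisting of $m$ pairwise disjoint edges. If $m\le\lfloor\tfrac12\,\overline{(\overline{m}+1)}\rfloor$, then $t_e(\mathcal E_{2m})+1\le t(\mathcal E_{2m})\le t_e(\mathcal E_{2m})+2$. Otherwise, $t(\mathcal E_{2m})=t_e(\mathcal E_{2m})+2$.
   Context: For an integer $n\ge2$, $\overline{n}=\min\{\binom{x}{\lfloor x/2\rfloor}: x\in\mathbb N,\ \binom{x}{\lfloor x/2\rfloor}\ge n\}$ (so $\overline{(\overline m+1)}$ applies this operation to $\overline m+1$). For a finite simple graph $G$, a family of subsets $B_v\subseteq[1,t]=\{1,\dots,t\}$, one for each vertex $v$, is a $G$-ECFF$(t,|V(G)|)$ if for every edge $\{a,b\}$ and every vertex $w\notin\{a,b\}$, $B_w\not\subseteq B_a\cup B_b$; it is a $G$-CFF$(t,|V(G)|)$ if in addition $B_a\not\subseteq B_b$ and $B_b\not\subseteq B_a$ for every edge $\{a,b\}$. $t_e(G)$ and $t(G)$ denote the minimum $t$ for which a $G$-ECFF, respectively a $G$-CFF, on $|V(G)|$ sets exists. -}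

module Defs where

open import Data.Nat using (ℕ; _≤_; _*_; _/_)
open import Data.Nat.Combinatorics using (_C_)
open import Data.Fin using (Fin; toℕ)
open import Data.Fin.Subset using (Subset; _⊆_; _∪_)
open import Data.Product using (Σ; ∃; _×_)
open import Relation.Binary.PropositionalEquality using (_≡_; _≢_)
open import Relation.Nullary using (¬_)

centralBinom : ℕ → ℕ
centralBinom x = x C (x / 2)

-- IsBar n v  :  v = overline(n) = min { binom(x, floor(x/2)) : binom(x, floor(x/2)) ≥ n }
IsBar : ℕ → ℕ → Set
IsBar n v = (∃ λ x → centralBinom x ≡ v) × n ≤ v
          × (∀ x → n ≤ centralBinom x → v ≤ centralBinom x)

record Graph (n : ℕ) : Set₁ where
  field
    Edge    : Fin n → Fin n → Set
    irrefl  : ∀ {a} → ¬ Edge a a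
    sym     : ∀ {a b} → Edge a b → Edge b a
open Graph public

IsECFF : ∀ {n} → Graph n → (t : ℕ) → (Fin n → Subset t) → Set
IsECFF G t B = ∀ a b w → Edge G a b → w ≢ a → w ≢ b → ¬ (B w ⊆ (B a ∪ B b))

IsCFF : ∀ {n} → Graph n → (t : ℕ) → (Fin n → Subset t) → Set
IsCFF G t B = IsECFF G t B
  × (∀ a b → Edge G a b → ¬ (B a ⊆ B b) × ¬ (B b ⊆ B a))

HasECFF : ∀ {n} → Graph n → ℕ → Set
HasECFF G t = Σ (Fin _ → Subset t) (IsECFF G t)

HasCFF : ∀ {n} → Graph n → ℕ → Set
HasCFF G t = Σ (Fin _ → Subset t) (IsCFF G t)

IsMin : (ℕ → Set) → ℕ → Set
IsMin P k = P k × (∀ t → P t → k ≤ t)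

-- E_{2m}: vertices 0..2m-1, edges {2k, 2k+1} for k < m (m pairwise disjoint edges)
matching : (m : ℕ) → Graph (2 * m)
matching m = record
  { Edge   = λ a b → (toℕ a / 2 ≡ toℕ b / 2) × a ≢ b
  ; irrefl = λ e → Data.Product.proj₂ e Relation.Binary.PropositionalEquality.refl
  ; sym    = λ { (p Data.Product., q) → Relation.Binary.PropositionalEquality.sym p
                   Data.Product., (λ e → q (Relation.Binary.PropositionalEquality.sym e)) }
  }

module Submission where

-- Sperner's theorem, proved through the LYM inequality, bounds an antichain of subsets of a t-set by
-- binom(t, ⌊t/2⌋), and the middle layer attains the bound. For m disjoint edges the ECFF condition
-- says that sets on different edges are never nested, so t_e is the least t with m ≤ binom(t, ⌊t/2⌋),
-- and binom(t_e, ⌊t_e/2⌋) ≤ b₁. A CFF makes all 2m sets an antichain, whence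
-- 2m ≤ binom(t, ⌊t/2⌋) ≤ 2 binom(t - 1, ⌊(t - 1)/2⌋) and t_e < t; two extra points coloured by the
-- parity of the vertex turn an ECFF into a CFF, so t ≤ t_e + 2. If t = t_e + 1, then
-- 2m ≤ binom(t_e + 1, ⌊(t_e + 1)/2⌋) ≤ b₂, as b₂ is a central binomial coefficient exceeding b₁;
-- that is, m ≤ b₂/2.

open import Data.Bool.Base using (not; if_then_else_)
open import Data.Empty using (⊥-elim)
open import Data.Fin.Base using (Fin; zero; suc; inject≤; toℕ; fromℕ<; opposite)
open import Data.Fin.Properties using (_≟_; inject≤-injective; toℕ-injective; toℕ<n; toℕ-fromℕ<)
open import Data.Fin.Subset using (Subset; _⊆_; _⊈_; _∪_; ∣_∣; ∁; ⊥; ⁅_⁆; inside; outside)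
open import Data.Fin.Subset.Properties
  using (drop-∷-⊆; out⊆; in⊆in; ⊆⊤; p⊆p∪q; ∪-idem; x∈⁅x⁆; x∈⁅y⁆⇒x≡y;
         ∣p∣≤n; ∣p∣≡n⇒p≡⊤; ∣∁p∣≡n∸∣p∣; ∣⊥∣≡0; p⊆q⇒∣p∣≤∣q∣)
open import Data.List.Base as List using (List; []; _∷_; _++_; map; filterᵇ; length; tabulate)
open import Data.List.Membership.Propositional.Properties using (∈-lookup)
open import Data.List.Properties using (map-cong-local; length-tabulate; length-++; length-map)
open import Data.List.Relation.Unary.All as All using (All; []; _∷_)
import Data.List.Relation.Unary.All.Properties as Allₚ
open import Data.List.Relation.Unary.AllPairs as AllPairs using (AllPairs; []; _∷_)
import Data.List.Relation.Unary.AllPairs.Properties as AllPairsₚ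
open import Data.Nat.Base hiding (parity)
open import Data.Nat.Combinatorics
  using (_C_; nCk≡n!/k![n-k]!; k![n∸k]!∣n!; nCk≡nC[n∸k]; nCk+nC[k+1]≡[n+1]C[k+1];
         [n-k]*d[k+1]≡[k+1]*d[k]; k>n⇒nCk≡0)
open import Data.Nat.Divisibility using (divides-refl)
open import Data.Nat.DivMod
  using (_mod_; m≡m%n+[m/n]*n; m/n≡1+[m∸n]/n; m/n*n≡m; m*n/n≡m; m<n⇒m/n≡0; m<n*o⇒m/o<n;
         +-distrib-/-∣ʳ; /-monoˡ-≤; [m+kn]%n≡m%n; m<n⇒m%n≡m)
open import Data.Nat.ListAction using (sum)
open import Data.Nat.Properties hiding (_≟_)
open import Data.Product.Base as Product using (_×_; _,_; proj₁; proj₂; Σ; ∃)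
open import Data.Sum.Base using (_⊎_; inj₁; inj₂; [_,_])
import Data.Vec.Base as Vec
open Vec using ([]; _∷_; here; there)
open import Data.Vec.Properties using (zipWith-++)
open import Function.Base using (flip; _∘_; case_of_)
open import Level using (Level; 0ℓ)
open import Relation.Binary.Core using (Rel)
open import Relation.Binary.Definitions using (Reflexive; Transitive)
open import Relation.Binary.PropositionalEquality
  using (_≡_; _≢_; refl; sym; trans; cong; cong₂; subst; subst₂; module ≡-Reasoning)
open import Relation.Nullary.Decidable.Core using (yes; no)
open import Relation.Nullary.Negation.Core using (¬_)

open import Defs hiding (sym)

open import Algebra.Properties.CommutativeMonoid.Sum +-0-commutativeMonoid
  using (sum-syntax; ∑-distrib-+; sum-replicate-zero; sum-cong-≗)
open import Algebra.Properties.CommutativeSemigroup *-commutativeSemigroup using (x∙yz≈y∙xz)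

private variable ℓ : Level

-- Binomial coefficients

consecutive⇒endpoints : (_R_ : Rel ℕ ℓ) → Reflexive _R_ → Transitive _R_ →
  (f : ℕ → ℕ) {a b : ℕ} → (∀ {k} → a ≤ k → k < b → f k R f (suc k)) → a ≤ b → f a R f b
consecutive⇒endpoints _ refl′ trans′ f {b = zero} step z≤n = refl′
consecutive⇒endpoints _R_ refl′ trans′ f {b = suc b} step a≤1+b with m≤n⇒m<n∨m≡n a≤1+b
... | inj₂ refl = refl′
... | inj₁ (s≤s a≤b) =
  trans′ (consecutive⇒endpoints _R_ refl′ trans′ f (λ a≤k k<b → step a≤k (m<n⇒m<1+n k<b)) a≤b)
         (step a≤b ≤-refl)

n/2≡⌊n/2⌋ : ∀ n → n / 2 ≡ ⌊ n /2⌋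
n/2≡⌊n/2⌋ 0 = refl
n/2≡⌊n/2⌋ 1 = refl
n/2≡⌊n/2⌋ (suc (suc n)) =
  trans (m/n≡1+[m∸n]/n {suc (suc n)} {2} (s≤s (s≤s z≤n))) (cong suc (n/2≡⌊n/2⌋ n))

2*m≤n⇒m≤n/2 : ∀ {m n} → 2 * m ≤ n → m ≤ n / 2
2*m≤n⇒m≤n/2 {m} {n} 2m≤n =
  subst (_≤ n / 2) (m*n/n≡m m 2) (/-monoˡ-≤ 2 (subst (_≤ n) (*-comm 2 m) 2m≤n))

⌊n/2⌋+⌊n/2⌋≤n : ∀ n → ⌊ n /2⌋ + ⌊ n /2⌋ ≤ n
⌊n/2⌋+⌊n/2⌋≤n 0 = z≤n
⌊n/2⌋+⌊n/2⌋≤n 1 = z≤n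
⌊n/2⌋+⌊n/2⌋≤n (suc (suc n)) rewrite +-suc ⌊ n /2⌋ ⌊ n /2⌋ = s≤s (s≤s (⌊n/2⌋+⌊n/2⌋≤n n))

n≤1+⌊n/2⌋+⌊n/2⌋ : ∀ n → n ≤ suc (⌊ n /2⌋ + ⌊ n /2⌋)
n≤1+⌊n/2⌋+⌊n/2⌋ 0 = z≤n
n≤1+⌊n/2⌋+⌊n/2⌋ 1 = s≤s z≤n
n≤1+⌊n/2⌋+⌊n/2⌋ (suc (suc n)) rewrite +-suc ⌊ n /2⌋ ⌊ n /2⌋ = s≤s (s≤s (n≤1+⌊n/2⌋+⌊n/2⌋ n))

-- k ! * (n ∸ k) ! is the number of maximal chains of subsets of an n-set through a fixed k-set.
chainCount : ℕ → ℕ → ℕ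
chainCount n k = k ! * (n ∸ k) !

chainCount≢0 : ∀ n k → NonZero (chainCount n k)
chainCount≢0 n k = k !* (n ∸ k) !≢0

nCk*chainCount≡n! : ∀ {n k} → k ≤ n → (n C k) * chainCount n k ≡ n !
nCk*chainCount≡n! {n} {k} k≤n = begin
  (n C k) * chainCount n k              ≡⟨ cong (_* chainCount n k) (nCk≡n!/k![n-k]! k≤n) ⟩
  (n ! / chainCount n k) {{chainCount≢0 n k}} * chainCount n k
    ≡⟨ m/n*n≡m {n !} {chainCount n k} {{chainCount≢0 n k}} (k![n∸k]!∣n! k≤n) ⟩
  n !                                   ∎
  where open ≡-Reasoning

chainCount-suc≤ : ∀ {n k} → suc (k + k) ≤ n → chainCount n (suc k) ≤ chainCount n k
chainCount-suc≤ {n} {k} 1+2k≤n =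
  *-cancelˡ-≤ {chainCount n (suc k)} {chainCount n k} (suc k) (begin
  suc k * chainCount n (suc k)   ≤⟨ *-monoˡ-≤ _ (m+n≤o⇒m≤o∸n (suc k) 1+2k≤n) ⟩
  (n ∸ k) * chainCount n (suc k) ≡⟨ [n-k]*d[k+1]≡[k+1]*d[k] (m+n≤o⇒m≤o (suc k) 1+2k≤n) ⟩
  suc k * chainCount n k         ∎)
  where open ≤-Reasoning

chainCount-≤suc : ∀ {n k} → k < n → n ≤ suc (k + k) → chainCount n k ≤ chainCount n (suc k)
chainCount-≤suc {n} {k} k<n n≤1+2k =
  *-cancelˡ-≤ {chainCount n k} {chainCount n (suc k)} (n ∸ k) {{>-nonZero (m<n⇒0<n∸m k<n)}} (begin
  (n ∸ k) * chainCount n k       ≤⟨ *-monoˡ-≤ _ (m≤n+o⇒m∸n≤o n k (subst (n ≤_) (sym (+-suc k k)) n≤1+2k)) ⟩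
  suc k * chainCount n k         ≡⟨ [n-k]*d[k+1]≡[k+1]*d[k] k<n ⟨
  (n ∸ k) * chainCount n (suc k) ∎)
  where open ≤-Reasoning

chainCount-minimal : ∀ {n k} → k ≤ n → chainCount n ⌊ n /2⌋ ≤ chainCount n k
chainCount-minimal {n} {k} k≤n with ≤-total k ⌊ n /2⌋
... | inj₁ k≤h = consecutive⇒endpoints _≥_ ≤-refl (flip ≤-trans) (chainCount n) descend k≤h
  where
    descend : ∀ {j} → k ≤ j → j < ⌊ n /2⌋ → chainCount n (suc j) ≤ chainCount n j
    descend {j} _ j<h = chainCount-suc≤ {n} {j} (≤-trans (+-mono-≤ j<h (<⇒≤ j<h)) (⌊n/2⌋+⌊n/2⌋≤n n))
... | inj₂ h≤k = consecutive⇒endpoints _≤_ ≤-refl ≤-trans (chainCount n) ascend h≤k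
  where
    ascend : ∀ {j} → ⌊ n /2⌋ ≤ j → j < k → chainCount n j ≤ chainCount n (suc j)
    ascend {j} h≤j j<k = chainCount-≤suc (<-≤-trans j<k k≤n)
      (≤-trans (n≤1+⌊n/2⌋+⌊n/2⌋ n) (s≤s (+-mono-≤ h≤j h≤j)))

nCk≤nC⌊n/2⌋ : ∀ n k → n C k ≤ n C ⌊ n /2⌋
nCk≤nC⌊n/2⌋ n k with k ≤? n
... | no k≰n = subst (_≤ n C ⌊ n /2⌋) (sym (k>n⇒nCk≡0 (≰⇒> k≰n))) z≤n
... | yes k≤n =
  *-cancelʳ-≤ (n C k) (n C ⌊ n /2⌋) (chainCount n ⌊ n /2⌋) {{chainCount≢0 n ⌊ n /2⌋}} (begin
  (n C k) * chainCount n ⌊ n /2⌋    ≤⟨ *-monoʳ-≤ (n C k) (chainCount-minimal k≤n) ⟩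
  (n C k) * chainCount n k          ≡⟨ nCk*chainCount≡n! k≤n ⟩
  n !                               ≡⟨ nCk*chainCount≡n! (⌊n/2⌋≤n n) ⟨
  (n C ⌊ n /2⌋) * chainCount n ⌊ n /2⌋ ∎)
  where open ≤-Reasoning

centralBinom≡ : ∀ x → centralBinom x ≡ x C ⌊ x /2⌋
centralBinom≡ x = cong (x C_) (n/2≡⌊n/2⌋ x)

-- Pascal's rule at the middle, after reflecting ⌊(x+1)/2⌋ to ⌈(x+1)/2⌉ = ⌊x/2⌋ + 1.
centralBinom-suc : ∀ x → centralBinom (suc x) ≡ x C ⌊ x /2⌋ + x C suc ⌊ x /2⌋
centralBinom-suc x = begin
  centralBinom (suc x)              ≡⟨ centralBinom≡ (suc x) ⟩
  suc x C ⌊ suc x /2⌋               ≡⟨ nCk≡nC[n∸k] (⌊n/2⌋≤n (suc x)) ⟩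
  suc x C (suc x ∸ ⌊ suc x /2⌋)     ≡⟨ cong (suc x C_) ⌈⌉-eq ⟩
  suc x C ⌈ suc x /2⌉               ≡⟨ nCk+nC[k+1]≡[n+1]C[k+1] x ⌊ x /2⌋ ⟨
  x C ⌊ x /2⌋ + x C suc ⌊ x /2⌋     ∎
  where
    open ≡-Reasoning
    ⌈⌉-eq : suc x ∸ ⌊ suc x /2⌋ ≡ ⌈ suc x /2⌉
    ⌈⌉-eq = trans (cong (_∸ ⌊ suc x /2⌋) (sym (⌊n/2⌋+⌈n/2⌉≡n (suc x))))
                  (m+n∸m≡n ⌊ suc x /2⌋ ⌈ suc x /2⌉)

centralBinom-≤-suc : ∀ x → centralBinom x ≤ centralBinom (suc x)
centralBinom-≤-suc x = begin
  centralBinom x                    ≡⟨ centralBinom≡ x ⟩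
  x C ⌊ x /2⌋                       ≤⟨ m≤m+n _ _ ⟩
  x C ⌊ x /2⌋ + x C suc ⌊ x /2⌋     ≡⟨ centralBinom-suc x ⟨
  centralBinom (suc x)              ∎
  where open ≤-Reasoning

centralBinom-suc≤ : ∀ x → centralBinom (suc x) ≤ 2 * centralBinom x
centralBinom-suc≤ x = begin
  centralBinom (suc x)              ≡⟨ centralBinom-suc x ⟩
  x C ⌊ x /2⌋ + x C suc ⌊ x /2⌋     ≤⟨ +-monoʳ-≤ _ (nCk≤nC⌊n/2⌋ x (suc ⌊ x /2⌋)) ⟩
  x C ⌊ x /2⌋ + x C ⌊ x /2⌋         ≡⟨ cong (λ y → y + y) (centralBinom≡ x) ⟨
  centralBinom x + centralBinom x   ≡⟨ cong (centralBinom x +_) (+-identityʳ (centralBinom x)) ⟨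
  2 * centralBinom x                ∎
  where open ≤-Reasoning

centralBinom-mono : ∀ {x y} → x ≤ y → centralBinom x ≤ centralBinom y
centralBinom-mono =
  consecutive⇒endpoints _≤_ ≤-refl ≤-trans centralBinom (λ {k} _ _ → centralBinom-≤-suc k)

centralBinom-suc≤bar : ∀ {x b b′} → centralBinom x ≤ b → IsBar (b + 1) b′ → centralBinom (suc x) ≤ b′
centralBinom-suc≤bar {x} {b} CBx≤b ((y , refl) , b+1≤CBy , _) = centralBinom-mono x<y
  where
    x<y : x < y
    x<y = ≰⇒> λ y≤x →
      <⇒≱ (subst (_≤ centralBinom y) (+-comm b 1) b+1≤CBy) (≤-trans (centralBinom-mono y≤x) CBx≤b)

-- Sperner's theorem

Incomparable : ∀ {n} → Rel (Subset n) 0ℓ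
Incomparable A B = A ⊈ B × B ⊈ A

Antichain : ∀ {n} → List (Subset n) → Set
Antichain = AllPairs Incomparable

IndexedAntichain : ∀ {k n} → (Fin k → Subset n) → Set
IndexedAntichain S = ∀ {i j} → i ≢ j → S i ⊈ S j

⊆-full : ∀ {n} {A B : Subset n} → ∣ A ∣ ≡ n → B ⊆ A
⊆-full ∣A∣≡n = subst (_ ⊆_) (sym (∣p∣≡n⇒p≡⊤ ∣A∣≡n)) ⊆⊤

incomparable⇒∣∣<n : ∀ {n} {A B : Subset n} → Incomparable A B → ∣ B ∣ < n
incomparable⇒∣∣<n {B = B} (A⊈B , _) = ≤∧≢⇒< (∣p∣≤n B) (λ ∣B∣≡n → A⊈B (⊆-full ∣B∣≡n))

removeAt-⊆⁻ : ∀ {n} (i : Fin (suc n)) {A B : Subset (suc n)} → Vec.lookup A i ≡ outside →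
  Vec.removeAt A i ⊆ Vec.removeAt B i → A ⊆ B
removeAt-⊆⁻ zero {_ ∷ _} {_ ∷ _} refl A′⊆B′ = out⊆ A′⊆B′
removeAt-⊆⁻ (suc i) {_ ∷ _ ∷ _} {_ ∷ _ ∷ _} _ A′⊆B′ here with A′⊆B′ here
... | here = here
removeAt-⊆⁻ (suc i) {_ ∷ _ ∷ _} {_ ∷ _ ∷ _} A[i]≡outside A′⊆B′ (there x∈A) =
  there (removeAt-⊆⁻ i A[i]≡outside (drop-∷-⊆ A′⊆B′) x∈A)

∣removeAt∣≡∣∣ : ∀ {n} (i : Fin (suc n)) (A : Subset (suc n)) → Vec.lookup A i ≡ outside →
  ∣ Vec.removeAt A i ∣ ≡ ∣ A ∣
∣removeAt∣≡∣∣ zero    (_ ∷ _) refl = refl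
∣removeAt∣≡∣∣ (suc i) (inside  ∷ A@(_ ∷ _)) A[i]≡outside = cong suc (∣removeAt∣≡∣∣ i A A[i]≡outside)
∣removeAt∣≡∣∣ (suc i) (outside ∷ A@(_ ∷ _)) A[i]≡outside = ∣removeAt∣≡∣∣ i A A[i]≡outside

removeAt-incomparable : ∀ {n} (i : Fin (suc n)) {A B : Subset (suc n)} →
  Vec.lookup A i ≡ outside → Vec.lookup B i ≡ outside →
  Incomparable A B → Incomparable (Vec.removeAt A i) (Vec.removeAt B i)
removeAt-incomparable i A[i]≡outside B[i]≡outside (A⊈B , B⊈A) =
  (λ s → A⊈B (removeAt-⊆⁻ i A[i]≡outside s)) , (λ s → B⊈A (removeAt-⊆⁻ i B[i]≡outside s))

restrictAt : ∀ {n} → Fin (suc n) → List (Subset (suc n)) → List (Subset n)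
restrictAt i F = map (λ A → Vec.removeAt A i) (filterᵇ (λ A → not (Vec.lookup A i)) F)

restrictAt-All : ∀ {n} (i : Fin (suc n)) {A} F → Vec.lookup A i ≡ outside →
  All (Incomparable A) F → All (Incomparable (Vec.removeAt A i)) (restrictAt i F)
restrictAt-All i [] _ [] = []
restrictAt-All i (B ∷ F) A[i]≡outside (A⋈B ∷ A⋈F) with Vec.lookup B i in B[i]≡
... | inside  = restrictAt-All i F A[i]≡outside A⋈F
... | outside = removeAt-incomparable i A[i]≡outside B[i]≡ A⋈B ∷ restrictAt-All i F A[i]≡outside A⋈F

restrictAt-antichain : ∀ {n} (i : Fin (suc n)) F → Antichain F → Antichain (restrictAt i F)
restrictAt-antichain i [] [] = []
restrictAt-antichain i (A ∷ F) (A⋈F ∷ ac) with Vec.lookup A i in A[i]≡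
... | inside  = restrictAt-antichain i F ac
... | outside = restrictAt-All i F A[i]≡ A⋈F ∷ restrictAt-antichain i F ac

lymSum : (n : ℕ) → List (Subset n) → ℕ
lymSum n F = sum (map (λ A → chainCount n ∣ A ∣) F)

lymSum-restrictAt : ∀ {n} (i : Fin (suc n)) F →
  lymSum n (restrictAt i F) ≡ sum (map (λ A → if Vec.lookup A i then 0 else chainCount n ∣ A ∣) F)
lymSum-restrictAt i [] = refl
lymSum-restrictAt {n} i (A ∷ F) with Vec.lookup A i in A[i]≡
... | inside  = lymSum-restrictAt i F
... | outside = cong₂ _+_ (cong (chainCount n) (∣removeAt∣≡∣∣ i A A[i]≡)) (lymSum-restrictAt i F)

∑-outside≡∣∁∣* : ∀ {k} (A : Subset k) x → ∑[ i < k ] (if Vec.lookup A i then 0 else x) ≡ ∣ ∁ A ∣ * x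
∑-outside≡∣∁∣* []            x = refl
∑-outside≡∣∁∣* (inside  ∷ A) x = ∑-outside≡∣∁∣* A x
∑-outside≡∣∁∣* (outside ∷ A) x = cong (x +_) (∑-outside≡∣∁∣* A x)

∑-sum-comm : ∀ {X : Set} {k} (f : Fin k → X → ℕ) (F : List X) →
  ∑[ i < k ] sum (map (f i) F) ≡ sum (map (λ x → ∑[ i < k ] f i x) F)
∑-sum-comm {k = k} f [] = sum-replicate-zero k
∑-sum-comm f (x ∷ F) =
  trans (∑-distrib-+ (λ i → f i x) (λ i → sum (map (f i) F))) (cong (_ +_) (∑-sum-comm f F))

∑-bound : ∀ {k c} (f : Fin k → ℕ) → (∀ i → f i ≤ c) → ∑[ i < k ] f i ≤ k * c
∑-bound {zero}  f f≤c = z≤n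
∑-bound {suc k} f f≤c = +-mono-≤ (f≤c zero) (∑-bound (λ i → f (suc i)) (λ i → f≤c (suc i)))

chainCount-suc : ∀ {n k} → k ≤ n → (suc n ∸ k) * chainCount n k ≡ chainCount (suc n) k
chainCount-suc {n} {k} k≤n = begin
  (suc n ∸ k) * (k ! * (n ∸ k) !)    ≡⟨ cong (_* chainCount n k) (+-∸-assoc 1 k≤n) ⟩
  suc (n ∸ k) * (k ! * (n ∸ k) !)    ≡⟨ x∙yz≈y∙xz (suc (n ∸ k)) (k !) ((n ∸ k) !) ⟩
  k ! * (suc (n ∸ k) * (n ∸ k) !)    ≡⟨ cong (λ d → k ! * d !) (+-∸-assoc 1 k≤n) ⟨
  k ! * (suc n ∸ k) !                ∎
  where open ≡-Reasoning

∑-outside-chainCount : ∀ {n} {A : Subset (suc n)} → ∣ A ∣ < suc n →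
  ∑[ i < suc n ] (if Vec.lookup A i then 0 else chainCount n ∣ A ∣) ≡ chainCount (suc n) ∣ A ∣
∑-outside-chainCount {n} {A} ∣A∣<1+n = begin
  ∑[ i < suc n ] (if Vec.lookup A i then 0 else chainCount n ∣ A ∣)
    ≡⟨ ∑-outside≡∣∁∣* A _ ⟩
  ∣ ∁ A ∣ * chainCount n ∣ A ∣
    ≡⟨ cong (_* chainCount n ∣ A ∣) (∣∁p∣≡n∸∣p∣ A) ⟩
  (suc n ∸ ∣ A ∣) * chainCount n ∣ A ∣
    ≡⟨ chainCount-suc (s≤s⁻¹ ∣A∣<1+n) ⟩
  chainCount (suc n) ∣ A ∣
    ∎
  where open ≡-Reasoning

-- Lubell's double count: a maximal chain through A ∈ F, read downwards from the full set, first
-- drops some point i ∉ A and then continues as a maximal chain through A's image in restrictAt i F.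
lym-step : ∀ {n} F → Antichain F → All (λ A → ∣ A ∣ < suc n) F →
  (∀ G → Antichain G → lymSum n G ≤ n !) → lymSum (suc n) F ≤ suc n !
lym-step {n} F ac nonfull lym-n = begin
  lymSum (suc n) F
    ≡⟨ cong sum (map-cong-local (All.map (λ {A} → sym ∘ ∑-outside-chainCount {A = A}) nonfull)) ⟩
  sum (map (λ A → ∑[ i < suc n ] g i A) F)
    ≡⟨ ∑-sum-comm g F ⟨
  ∑[ i < suc n ] sum (map (g i) F)
    ≡⟨ sum-cong-≗ (λ i → lymSum-restrictAt i F) ⟨
  ∑[ i < suc n ] lymSum n (restrictAt i F)
    ≤⟨ ∑-bound _ (λ i → lym-n (restrictAt i F) (restrictAt-antichain i F ac)) ⟩
  suc n * n !
    ∎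
  where
    open ≤-Reasoning
    g : Fin (suc n) → Subset (suc n) → ℕ
    g i A = if Vec.lookup A i then 0 else chainCount n ∣ A ∣

lym-full : ∀ {n} {A : Subset n} {F} → ∣ A ∣ ≡ n → All (Incomparable A) F → lymSum n (A ∷ F) ≤ n !
lym-full {n} ∣A∣≡n [] rewrite ∣A∣≡n | n∸n≡0 n = ≤-reflexive (trans (+-identityʳ _) (*-identityʳ _))
lym-full ∣A∣≡n ((_ , B⊈A) ∷ _) = ⊥-elim (B⊈A (⊆-full ∣A∣≡n))

lym : ∀ n F → Antichain F → lymSum n F ≤ n !
lym n [] [] = z≤n
lym n (A ∷ F) (A⋈F ∷ ac) with m≤n⇒m<n∨m≡n (∣p∣≤n A)
lym n       (A ∷ F) (A⋈F ∷ ac) | inj₂ ∣A∣≡n = lym-full ∣A∣≡n A⋈F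
lym zero    (A ∷ F) (A⋈F ∷ ac) | inj₁ ()
lym (suc n) (A ∷ F) (A⋈F ∷ ac) | inj₁ ∣A∣<1+n =
  lym-step (A ∷ F) (A⋈F ∷ ac) (∣A∣<1+n ∷ All.map incomparable⇒∣∣<n A⋈F) (lym n)

length*chainCount≤lymSum : ∀ n F → length F * chainCount n ⌊ n /2⌋ ≤ lymSum n F
length*chainCount≤lymSum n [] = z≤n
length*chainCount≤lymSum n (A ∷ F) =
  +-mono-≤ (chainCount-minimal (∣p∣≤n A)) (length*chainCount≤lymSum n F)

sperner : ∀ n F → Antichain F → length F ≤ n C ⌊ n /2⌋
sperner n F ac =
  *-cancelʳ-≤ (length F) (n C ⌊ n /2⌋) (chainCount n ⌊ n /2⌋) {{chainCount≢0 n ⌊ n /2⌋}} (begin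
  length F * chainCount n ⌊ n /2⌋         ≤⟨ length*chainCount≤lymSum n F ⟩
  lymSum n F                              ≤⟨ lym n F ac ⟩
  n !                                     ≡⟨ nCk*chainCount≡n! (⌊n/2⌋≤n n) ⟨
  (n C ⌊ n /2⌋) * chainCount n ⌊ n /2⌋    ∎)
  where open ≤-Reasoning

sperner-indexed : ∀ {k n} {S : Fin k → Subset n} → IndexedAntichain S → k ≤ n C ⌊ n /2⌋
sperner-indexed {k} {n} {S} anti = subst (_≤ n C ⌊ n /2⌋) (length-tabulate S)
  (sperner n (tabulate S) (AllPairsₚ.tabulate⁺ (λ i≢j → anti i≢j , anti (i≢j ∘ sym))))

subsetsOfSize : (n k : ℕ) → List (Subset n)
subsetsOfSize n       zero    = ⊥ ∷ []
subsetsOfSize zero    (suc k) = []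
subsetsOfSize (suc n) (suc k) =
  map (outside ∷_) (subsetsOfSize n (suc k)) ++ map (inside ∷_) (subsetsOfSize n k)

length-subsetsOfSize : ∀ n k → length (subsetsOfSize n k) ≡ n C k
length-subsetsOfSize n       zero    = refl
length-subsetsOfSize zero    (suc k) = refl
length-subsetsOfSize (suc n) (suc k) = begin
  length (map (outside ∷_) Xs ++ map (inside ∷_) Ys)
    ≡⟨ length-++ (map (outside ∷_) Xs) ⟩
  length (map (outside ∷_) Xs) + length (map (inside ∷_) Ys)
    ≡⟨ cong₂ _+_ (length-map _ Xs) (length-map _ Ys) ⟩
  length Xs + length Ys
    ≡⟨ cong₂ _+_ (length-subsetsOfSize n (suc k)) (length-subsetsOfSize n k) ⟩
  n C suc k + n C k
    ≡⟨ +-comm (n C suc k) (n C k) ⟩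
  n C k + n C suc k
    ≡⟨ nCk+nC[k+1]≡[n+1]C[k+1] n k ⟩
  suc n C suc k
    ∎
  where
    open ≡-Reasoning
    Xs = subsetsOfSize n (suc k)
    Ys = subsetsOfSize n k

subsetsOfSize-∣∣ : ∀ n k → All (λ A → ∣ A ∣ ≡ k) (subsetsOfSize n k)
subsetsOfSize-∣∣ n       zero    = ∣⊥∣≡0 n ∷ []
subsetsOfSize-∣∣ zero    (suc k) = []
subsetsOfSize-∣∣ (suc n) (suc k) =
  Allₚ.++⁺ (Allₚ.map⁺ (subsetsOfSize-∣∣ n (suc k)))
           (Allₚ.map⁺ (All.map (cong suc) (subsetsOfSize-∣∣ n k)))

∷-incomparable : ∀ {n} {A B : Subset n} {x} → Incomparable A B → Incomparable (x ∷ A) (x ∷ B)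
∷-incomparable (A⊈B , B⊈A) = (λ s → A⊈B (drop-∷-⊆ s)) , (λ s → B⊈A (drop-∷-⊆ s))

outside∷-incomparable-inside∷ : ∀ {n k} {A B : Subset n} → ∣ A ∣ ≡ suc k → ∣ B ∣ ≡ k →
  Incomparable (outside ∷ A) (inside ∷ B)
outside∷-incomparable-inside∷ ∣A∣≡1+k ∣B∣≡k =
  (λ s → 1+n≰n (subst₂ _≤_ ∣A∣≡1+k ∣B∣≡k (p⊆q⇒∣p∣≤∣q∣ (drop-∷-⊆ s)))) , (λ s → case s here of λ ())

subsetsOfSize-antichain : ∀ n k → Antichain (subsetsOfSize n k)
subsetsOfSize-antichain n       zero    = [] ∷ []
subsetsOfSize-antichain zero    (suc k) = []
subsetsOfSize-antichain (suc n) (suc k) = AllPairsₚ.++⁺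
  (AllPairsₚ.map⁺ (AllPairs.map ∷-incomparable (subsetsOfSize-antichain n (suc k))))
  (AllPairsₚ.map⁺ (AllPairs.map ∷-incomparable (subsetsOfSize-antichain n k)))
  (Allₚ.map⁺ (All.map (λ ∣A∣≡1+k → Allₚ.map⁺ (All.map (outside∷-incomparable-inside∷ ∣A∣≡1+k)
                                                       (subsetsOfSize-∣∣ n k)))
                      (subsetsOfSize-∣∣ n (suc k))))

lookup-antichain : ∀ {n} {F : List (Subset n)} → Antichain F →
  ∀ {i j} → i ≢ j → List.lookup F i ⊈ List.lookup F j
lookup-antichain (_   ∷ _)  {zero}  {zero}  i≢j = ⊥-elim (i≢j refl)
lookup-antichain (A⋈F ∷ _)  {zero}  {suc j} _   = proj₁ (All.lookup A⋈F (∈-lookup j))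
lookup-antichain (A⋈F ∷ _)  {suc i} {zero}  _   = proj₂ (All.lookup A⋈F (∈-lookup i))
lookup-antichain (_   ∷ ac) {suc i} {suc j} i≢j = lookup-antichain ac (i≢j ∘ cong suc)

indexedAntichain : ∀ {k n} r → k ≤ n C r → Σ (Fin k → Subset n) IndexedAntichain
indexedAntichain {k} {n} r k≤nCr = S , λ {i} {j} i≢j →
  lookup-antichain (subsetsOfSize-antichain n r) (i≢j ∘ inject≤-injective _ _ i j)
  where
    k≤length : k ≤ length (subsetsOfSize n r)
    k≤length = ≤-trans k≤nCr (≤-reflexive (sym (length-subsetsOfSize n r)))
    S : Fin k → Subset n
    S i = List.lookup (subsetsOfSize n r) (inject≤ i k≤length)

-- Conflict-free families

IsECFF⇒⊈ : ∀ {n t} {G : Graph n} {B : Fin n → Subset t} → IsECFF G t B →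
  ∀ {a b w} → Edge G a b → w ≢ a → w ≢ b → B w ⊈ B a
IsECFF⇒⊈ {B = B} ecff {a} {b} {w} a~b w≢a w≢b Bw⊆Ba =
  ecff a b w a~b w≢a w≢b (λ x∈Bw → p⊆p∪q (B b) (Bw⊆Ba x∈Bw))

IsCFF⇒indexedAntichain : ∀ {n t} {G : Graph n} {B : Fin n → Subset t} →
  (∀ v → ∃ (Edge G v)) → IsCFF G t B → IndexedAntichain B
IsCFF⇒indexedAntichain {G = G} neighbour (ecff , edge⇒incomparable) {v} {w} v≢w with neighbour w
... | p , w~p with v ≟ p
...   | yes refl = proj₂ (edge⇒incomparable w v w~p)
...   | no v≢p   = IsECFF⇒⊈ {G = G} ecff w~p v≢w v≢p

ProperColouring : ∀ {n k} → Graph n → (Fin n → Fin k) → Set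
ProperColouring G χ = ∀ {a b} → Edge G a b → χ a ≢ χ b

++-⊆⁻ : ∀ {k t} (P Q : Subset k) {X Y : Subset t} → P Vec.++ X ⊆ Q Vec.++ Y → P ⊆ Q × X ⊆ Y
++-⊆⁻ []            []            s = (λ ()) , s
++-⊆⁻ (outside ∷ P) (_       ∷ Q) s = Product.map₁ out⊆ (++-⊆⁻ P Q (drop-∷-⊆ s))
++-⊆⁻ (inside  ∷ P) (inside  ∷ Q) s = Product.map₁ in⊆in (++-⊆⁻ P Q (drop-∷-⊆ s))
++-⊆⁻ (inside  ∷ P) (outside ∷ Q) s = case s here of λ ()

-- The k colour points separate the two ends of each edge, and discarding them shows that the
-- ECFF condition survives.
HasECFF⇒HasCFF : ∀ {n k t} {G : Graph n} {χ : Fin n → Fin k} → ProperColouring G χ →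
  HasECFF G t → HasCFF G (k + t)
HasECFF⇒HasCFF {G = G} {χ} proper (B , ecff) =
  B′ , ecff′ , λ a b a~b → incomparable a~b , incomparable (Graph.sym G a~b)
  where
    B′ : Fin _ → Subset _
    B′ v = ⁅ χ v ⁆ Vec.++ B v
    ecff′ : IsECFF G _ B′
    ecff′ a b w a~b w≢a w≢b B′w⊆ = ecff a b w a~b w≢a w≢b
      (proj₂ (++-⊆⁻ ⁅ χ w ⁆ (⁅ χ a ⁆ ∪ ⁅ χ b ⁆)
        (subst (B′ w ⊆_) (zipWith-++ _ ⁅ χ a ⁆ (B a) ⁅ χ b ⁆ (B b)) B′w⊆)))
    incomparable : ∀ {a b} → Edge G a b → ¬ (B′ a ⊆ B′ b)
    incomparable {a} {b} a~b B′a⊆B′b =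
      proper a~b (x∈⁅y⁆⇒x≡y (χ b) (proj₁ (++-⊆⁻ ⁅ χ a ⁆ ⁅ χ b ⁆ B′a⊆B′b) (x∈⁅x⁆ (χ a))))

-- The matching on 2m vertices

opposite≢ : (c : Fin 2) → opposite c ≢ c
opposite≢ zero       ()
opposite≢ (suc zero) ()

fin2-either : ∀ {x y z : Fin 2} → x ≢ y → z ≡ x ⊎ z ≡ y
fin2-either {zero}     {zero}               x≢y = ⊥-elim (x≢y refl)
fin2-either {suc zero} {suc zero}           x≢y = ⊥-elim (x≢y refl)
fin2-either {zero}     {suc zero} {zero}     _  = inj₁ refl
fin2-either {zero}     {suc zero} {suc zero} _  = inj₂ refl
fin2-either {suc zero} {zero}     {zero}     _  = inj₂ refl
fin2-either {suc zero} {zero}     {suc zero} _  = inj₁ refl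

module _ {m : ℕ} where

  vertex : Fin m → Fin 2 → Fin (2 * m)
  vertex q c = fromℕ< (begin-strict
    toℕ c + toℕ q * 2  <⟨ +-monoˡ-< (toℕ q * 2) (toℕ<n c) ⟩
    suc (toℕ q) * 2    ≤⟨ *-monoˡ-≤ 2 (toℕ<n q) ⟩
    m * 2              ≡⟨ *-comm m 2 ⟩
    2 * m              ∎)
    where open ≤-Reasoning

  half : Fin (2 * m) → Fin m
  half v = fromℕ< (m<n*o⇒m/o<n (subst (toℕ v <_) (*-comm 2 m) (toℕ<n v)))

  parity : Fin (2 * m) → Fin 2
  parity v = toℕ v mod 2

  toℕ-vertex : ∀ (q : Fin m) (c : Fin 2) → toℕ (vertex q c) ≡ toℕ c + toℕ q * 2
  toℕ-vertex q c = toℕ-fromℕ< _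

  toℕ-half : ∀ (v : Fin (2 * m)) → toℕ (half v) ≡ toℕ v / 2
  toℕ-half v = toℕ-fromℕ< _

  toℕ-parity : ∀ (v : Fin (2 * m)) → toℕ (parity v) ≡ toℕ v % 2
  toℕ-parity v = toℕ-fromℕ< _

  vertex-half-parity : ∀ (v : Fin (2 * m)) → vertex (half v) (parity v) ≡ v
  vertex-half-parity v = toℕ-injective (begin
    toℕ (vertex (half v) (parity v))   ≡⟨ toℕ-vertex (half v) (parity v) ⟩
    toℕ (parity v) + toℕ (half v) * 2  ≡⟨ cong₂ (λ r q → r + q * 2) (toℕ-parity v) (toℕ-half v) ⟩
    toℕ v % 2 + toℕ v / 2 * 2          ≡⟨ m≡m%n+[m/n]*n (toℕ v) 2 ⟨
    toℕ v                              ∎)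
    where open ≡-Reasoning

  half-vertex : ∀ (q : Fin m) (c : Fin 2) → half (vertex q c) ≡ q
  half-vertex q c = toℕ-injective (begin
    toℕ (half (vertex q c))    ≡⟨ toℕ-half (vertex q c) ⟩
    toℕ (vertex q c) / 2       ≡⟨ cong (_/ 2) (toℕ-vertex q c) ⟩
    (toℕ c + toℕ q * 2) / 2    ≡⟨ +-distrib-/-∣ʳ (toℕ c) (divides-refl (toℕ q)) ⟩
    toℕ c / 2 + toℕ q * 2 / 2  ≡⟨ cong₂ _+_ (m<n⇒m/n≡0 (toℕ<n c)) (m*n/n≡m (toℕ q) 2) ⟩
    toℕ q                      ∎)
    where open ≡-Reasoning

  parity-vertex : ∀ (q : Fin m) (c : Fin 2) → parity (vertex q c) ≡ c
  parity-vertex q c = toℕ-injective (begin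
    toℕ (parity (vertex q c))  ≡⟨ toℕ-parity (vertex q c) ⟩
    toℕ (vertex q c) % 2       ≡⟨ cong (_% 2) (toℕ-vertex q c) ⟩
    (toℕ c + toℕ q * 2) % 2    ≡⟨ [m+kn]%n≡m%n (toℕ c) (toℕ q) 2 ⟩
    toℕ c % 2                  ≡⟨ m<n⇒m%n≡m (toℕ<n c) ⟩
    toℕ c                      ∎)
    where open ≡-Reasoning

  half-parity-injective : ∀ {v w : Fin (2 * m)} → half v ≡ half w → parity v ≡ parity w → v ≡ w
  half-parity-injective {v = v} {w} hv≡hw pv≡pw = begin
    v                              ≡⟨ vertex-half-parity v ⟨
    vertex (half v) (parity v)     ≡⟨ cong₂ vertex hv≡hw pv≡pw ⟩
    vertex (half w) (parity w)     ≡⟨ vertex-half-parity w ⟩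
    w                              ∎
    where open ≡-Reasoning

  edge⇒half≡ : ∀ {a b : Fin (2 * m)} → Edge (matching m) a b → half a ≡ half b
  edge⇒half≡ {a = a} {b} (a/2≡b/2 , _) =
    toℕ-injective (trans (toℕ-half a) (trans a/2≡b/2 (sym (toℕ-half b))))

  parity-proper : ProperColouring (matching m) parity
  parity-proper a~b@(_ , a≢b) pa≡pb = a≢b (half-parity-injective (edge⇒half≡ a~b) pa≡pb)

  matching-neighbour : ∀ (v : Fin (2 * m)) → ∃ (Edge (matching m) v)
  matching-neighbour v = p , v/2≡p/2 , v≢p
    where
      c = opposite (parity v)
      p = vertex (half v) c
      v/2≡p/2 : toℕ v / 2 ≡ toℕ p / 2
      v/2≡p/2 = trans (sym (toℕ-half v)) (trans (cong toℕ (sym (half-vertex (half v) c))) (toℕ-half p))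
      v≢p : v ≢ p
      v≢p v≡p = opposite≢ (parity v) (sym (trans (cong parity v≡p) (parity-vertex (half v) c)))

  same-half⇒endpoint : ∀ {a b w : Fin (2 * m)} → Edge (matching m) a b → half w ≡ half a →
    w ≡ a ⊎ w ≡ b
  same-half⇒endpoint {w = w} a~b hw≡ha with fin2-either {z = parity w} (parity-proper a~b)
  ... | inj₁ pw≡pa = inj₁ (half-parity-injective hw≡ha pw≡pa)
  ... | inj₂ pw≡pb = inj₂ (half-parity-injective (trans hw≡ha (edge⇒half≡ a~b)) pw≡pb)

  matching-IsECFF⇒⊈ : ∀ {t} {B : Fin (2 * m) → Subset t} → IsECFF (matching m) t B →
    ∀ {v w} → half w ≢ half v → B w ⊈ B v
  matching-IsECFF⇒⊈ ecff {v} hw≢hv with matching-neighbour v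
  ... | p , v~p = IsECFF⇒⊈ {G = matching m} ecff v~p (hw≢hv ∘ cong half)
    (λ w≡p → hw≢hv (trans (cong half w≡p) (sym (edge⇒half≡ v~p))))

  HasECFF-matching⇒ : ∀ {t} → HasECFF (matching m) t → m ≤ centralBinom t
  HasECFF-matching⇒ {t} (B , ecff) = subst (m ≤_) (sym (centralBinom≡ t))
    (sperner-indexed {S = λ i → B (vertex i zero)} λ {i} {j} i≢j →
      matching-IsECFF⇒⊈ ecff λ hᵢ≡hⱼ → i≢j (trans (sym (half-vertex i zero)) (trans hᵢ≡hⱼ (half-vertex j zero))))

  HasECFF-matching⇐ : ∀ {t} → m ≤ centralBinom t → HasECFF (matching m) t
  HasECFF-matching⇐ {t} m≤CBt with indexedAntichain ⌊ t /2⌋ (subst (m ≤_) (centralBinom≡ t) m≤CBt)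
  ... | S , anti = (λ v → S (half v)) , ecff
    where
      ecff : IsECFF (matching m) t (λ v → S (half v))
      ecff a b w a~b w≢a w≢b Sw⊆Sa∪Sb = anti (λ hw≡ha → [ w≢a , w≢b ] (same-half⇒endpoint a~b hw≡ha))
        (subst (S (half w) ⊆_) Sa∪Sb≡Sa Sw⊆Sa∪Sb)
        where
          Sa∪Sb≡Sa : S (half a) ∪ S (half b) ≡ S (half a)
          Sa∪Sb≡Sa = trans (cong (λ q → S (half a) ∪ S q) (sym (edge⇒half≡ a~b))) (∪-idem _)

  HasCFF-matching⇒ : ∀ {t} → HasCFF (matching m) t → 2 * m ≤ centralBinom t
  HasCFF-matching⇒ {t} (B , cff) = subst (2 * m ≤_) (sym (centralBinom≡ t))
    (sperner-indexed (IsCFF⇒indexedAntichain {G = matching m} matching-neighbour cff))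

  HasECFF⇒HasCFF-matching : ∀ {t} → HasECFF (matching m) t → HasCFF (matching m) (t + 2)
  HasECFF⇒HasCFF-matching {t} ecff =
    subst (HasCFF (matching m)) (+-comm 2 t) (HasECFF⇒HasCFF {G = matching m} parity-proper ecff)

  HasCFF-matching-suc⇒HasECFF : ∀ {t} → HasCFF (matching m) (suc t) → HasECFF (matching m) t
  HasCFF-matching-suc⇒HasECFF {t = t} cff =
    HasECFF-matching⇐ (*-cancelˡ-≤ 2 (≤-trans (HasCFF-matching⇒ cff) (centralBinom-suc≤ t)))

minECFF<HasCFF : ∀ {m te t} → 1 ≤ m → IsMin (HasECFF (matching m)) te → HasCFF (matching m) t → te < t
minECFF<HasCFF {m} {t = zero}  1≤m _          cff =
  ⊥-elim (1+n≰n (≤-trans (*-monoʳ-≤ 2 1≤m) (HasCFF-matching⇒ {m} cff)))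
minECFF<HasCFF {m} {t = suc t} _   (_ , minE) cff = s≤s (minE t (HasCFF-matching-suc⇒HasECFF {m} cff))

centralBinom[minECFF]≤bar : ∀ {m te b} → IsMin (HasECFF (matching m)) te → IsBar m b → centralBinom te ≤ b
centralBinom[minECFF]≤bar (_ , minE) ((x , refl) , m≤CBx , _) =
  centralBinom-mono (minE x (HasECFF-matching⇐ m≤CBx))

proposition5p9 : (m : ℕ) → 2 ≤ m
    → (te tc : ℕ) → IsMin (HasECFF (matching m)) te → IsMin (HasCFF (matching m)) tc
    → (b₁ b₂ : ℕ) → IsBar m b₁ → IsBar (b₁ + 1) b₂
    → (m ≤ b₂ / 2 → (te + 1 ≤ tc) × (tc ≤ te + 2))
    × (b₂ / 2 < m → tc ≡ te + 2)
proposition5p9 m 2≤m te tc minE@(hasE , _) (hasC , minC) b₁ b₂ bar₁ bar₂ =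
  (λ _ → te+1≤tc , tc≤te+2) , λ b₂/2<m → ≤-antisym tc≤te+2 (te+2≤tc b₂/2<m)
  where
    te<tc : te < tc
    te<tc = minECFF<HasCFF (≤-trans (n≤1+n 1) 2≤m) minE hasC
    te+1≤tc : te + 1 ≤ tc
    te+1≤tc = subst (_≤ tc) (+-comm 1 te) te<tc
    tc≤te+2 : tc ≤ te + 2
    tc≤te+2 = minC (te + 2) (HasECFF⇒HasCFF-matching {m} hasE)
    te+2≤tc : b₂ / 2 < m → te + 2 ≤ tc
    te+2≤tc b₂/2<m = subst (_≤ tc) (+-comm 2 te) (≤∧≢⇒< te<tc 1+te≢tc)
      where
        1+te≢tc : suc te ≢ tc
        1+te≢tc 1+te≡tc = <⇒≱ b₂/2<m (2*m≤n⇒m≤n/2 (≤-trans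
          (HasCFF-matching⇒ {m} (subst (HasCFF (matching m)) (sym 1+te≡tc) hasC))
          (centralBinom-suc≤bar {te} (centralBinom[minECFF]≤bar {m} minE bar₁) bar₂)))
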